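{- Let $n,s\ge1$ and let $C=C_0\lessdot C_1\lessdot\cdots\lessdot C_n$ be a decreasing maximal chain of $\Pi_{n,s+1}$ (so $C_0=\hat0$). Then $A(C_i)\ne A(C_{i+1})$ for all $i\in\{1,\ldots,n-1\}$.
   Context: A vector partition of $[n]$ into $s+1$ components is a tuple $(P,w^1,\ldots,w^s)$ where $P$ is a set partition of $[n]$ and each $w^i$ assigns to every part $B$ of $P$ a label $w^i(B)\subseteq[n]$ (its $i$-th label) with $|w^i(B)|=|B|$, such that the $i$-th labels of all parts form a partition of $[n]$. $\Pi_{n,s+1}$ is the set of these tuples together with an added least element $\hat0$, ordered by $(P,w)\le(P',w')$ iff every part $B'$ of $P'$ is a union of parts of $P$ and, for each $i$, $w^{i\prime}(B')$ is the union of $w^i(B)$ over the parts $B\subseteq B'$ of $P$. Atoms: the elements whose partition is $\{1\},\ldots,\{n\}$; such an atom with $w^i(\{k\})=\{w^i_k\}$ is identified with the word $w^1_1\cdots w^1_n\cdots w^s_1\cdots w^s_n\in[n]^{ns}$, ordered lexicographically. For $x\ne\hat0$, $A(x)$ is the lexicographically least atom below $x$; explicitly, if $\{k_1<\cdots<k_p\}$ is a part of $x$ with $i$-th label $\{j_1<\cdots<j_p\}$, then $A(x)$ has $w^i_{k_a}=j_a$. Write $w^i_k(x)$ for the entry $w^i_k$ of $A(x)$. The edge labeling $\lambda$ maps covering relations to $\mathbb Z^3$ ordered lexicographically: - if $x\lessdot y$, $x\ne\hat0$, $A(x)\ne A(y)$: $\lambda(x\lessdot y)=(k,i,j)$ where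 $(k,i)$ is the lexicographically least pair (first by $k$, then by $i$) with $w^i_k(x)\ne w^i_k(y)$, and $j=w^i_k(y)$; - if $x\lessdot y$, $x\ne\hat0$, $A(x)=A(y)$: $\lambda(x\lessdot y)=(n,\max(I\cup J),0)$ where $I,J$ are the parts of the partition of $x$ merged to form that of $y$; - $\lambda(\hat0\lessdot a)=(n-1,s+m,0)$ where $a$ is the $m$-th atom in lexicographic order. A maximal chain is decreasing if its sequence of edge labels (read from bottom to top) is weakly decreasing. -}

module Defs where

open import Data.Nat using (ℕ; zero; suc; _+_; _∸_; _<_; _≤_)
open import Data.Fin using (Fin; toℕ)
import Data.Fin as F
open import Data.Fin.Subset using (Subset; _∈_; _∉_; _⊆_; _∪_; ⁅_⁆; ∣_∣)
open import Data.Product using (Σ; ∃; ∃-syntax; _×_; _,_)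
open import Data.Sum using (_⊎_)
open import Data.Empty using (⊥)
open import Data.Unit using (⊤)
open import Relation.Nullary using (¬_)
open import Relation.Binary.PropositionalEquality using (_≡_; _≢_)

-- Raw data of a vector partition of [n] = Fin n into s+1 components.
--   part k      = the part B of P containing k
--   label i k   = the i-th label w^i(B) of the part B containing k
-- (i ranges over Fin s, i.e. the labels w^1,...,w^s)

record VecPart (n s : ℕ) : Set where
  field
    part  : Fin n → Subset n
    label : Fin s → Fin n → Subset n
open VecPart public

record IsVecPart {n s : ℕ} (v : VecPart n s) : Set where
  field
    self∈part    : ∀ k → k ∈ part v k
    part-coh     : ∀ k l → l ∈ part v k → part v l ≡ part v k
    label-coh    : ∀ i k l → l ∈ part v k → label v i l ≡ label v i k
    label-size   : ∀ i k → ∣ label v i k ∣ ≡ ∣ part v k ∣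
    label-cover  : ∀ i j → ∃[ k ] (j ∈ label v i k)
    label-disj   : ∀ i j k l → j ∈ label v i k → j ∈ label v i l →
                   part v k ≡ part v l

_≈V_ : {n s : ℕ} → VecPart n s → VecPart n s → Set
v ≈V w = (∀ k → part v k ≡ part w k) × (∀ i k → label v i k ≡ label w i k)

-- (P,w) ≤ (P',w'): every part of P' is a union of parts of P (equivalently
-- every part of P lies inside a part of P'), and each i-th label of a
-- part B' of P' is the union of the i-th labels of the parts of P inside B'.
_≤V_ : {n s : ℕ} → VecPart n s → VecPart n s → Set
v ≤V w = (∀ k → part v k ⊆ part w k)
       × (∀ i k j → (j ∈ label w i k → ∃[ l ] (l ∈ part w k × j ∈ label v i l))
                  × (∀ l → l ∈ part w k → j ∈ label v i l → j ∈ label w i k))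

-- The poset Π_{n,s+1}: vector partitions plus an added least element 0̂.

data Π (n s : ℕ) : Set where
  0̂  : Π n s
  el : VecPart n s → Π n s

InΠ : {n s : ℕ} → Π n s → Set
InΠ 0̂      = ⊤
InΠ (el v) = IsVecPart v

_≈_ : {n s : ℕ} → Π n s → Π n s → Set
0̂    ≈ 0̂    = ⊤
0̂    ≈ el _ = ⊥
el _ ≈ 0̂    = ⊥
el v ≈ el w = v ≈V w

_≤Π_ : {n s : ℕ} → Π n s → Π n s → Set
0̂    ≤Π _    = ⊤
el _ ≤Π 0̂    = ⊥
el v ≤Π el w = v ≤V w

_<Π_ : {n s : ℕ} → Π n s → Π n s → Set
x <Π y = x ≤Π y × ¬ (x ≈ y)

-- covering relation in Π_{n,s+1} (x and y themselves assumed in Π)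
_⋖_ : {n s : ℕ} → Π n s → Π n s → Set
x ⋖ y = x <Π y × (∀ z → InΠ z → x <Π z → ¬ (z <Π y))

IsAtom : {n s : ℕ} → VecPart n s → Set
IsAtom v = IsVecPart v × (∀ k → part v k ≡ ⁅ k ⁆)

-- positions of the word w^1_1 ... w^1_n ... w^s_1 ... w^s_n: (i,k) with i major
_<pos_ : {n s : ℕ} → (Fin s × Fin n) → (Fin s × Fin n) → Set
(i , k) <pos (i' , k') = (i F.< i') ⊎ (i ≡ i' × k F.< k')

-- lexicographic order of atoms (as words); for an atom, label v i k = {w^i_k}
_<lex_ : {n s : ℕ} → VecPart n s → VecPart n s → Set
_<lex_ {n} {s} a b =
  ∃[ i ] ∃[ k ] ∃[ j ] ∃[ j' ]
    ( (∀ i' k' → (i' , k') <pos (i , k) → label a i' k' ≡ label b i' k')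
    × j ∈ label a i k × j' ∈ label b i k × j F.< j' )

_≤lex_ : {n s : ℕ} → VecPart n s → VecPart n s → Set
a ≤lex b = a <lex b ⊎ a ≈V b

-- a is the m-th atom in lexicographic order: the atoms lexicographically
-- smaller than a are exactly m-1 many (enumerated without repetition by f).
AtomIndex : {n s : ℕ} → VecPart n s → ℕ → Set
AtomIndex {n} {s} a m =
  Σ ℕ λ m' → m ≡ suc m' × Σ (Fin m' → VecPart n s) λ f →
      (∀ r → IsAtom (f r) × f r <lex a)
    × (∀ r r' → f r ≈V f r' → r ≡ r')
    × (∀ b → IsAtom b → b <lex a → ∃[ r ] (f r ≈V b))

IsA : {n s : ℕ} → Π n s → VecPart n s → Set
IsA x a = IsAtom a × el a ≤Π x × (∀ b → IsAtom b → el b ≤Π x → a ≤lex b)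

-- Edge labels in ℤ³ (all entries here are natural numbers), ordered
-- lexicographically.

Label : Set
Label = ℕ × ℕ × ℕ

_≤L_ : Label → Label → Set
(a₁ , a₂ , a₃) ≤L (b₁ , b₂ , b₃) =
  a₁ < b₁ ⊎ (a₁ ≡ b₁ × (a₂ < b₂ ⊎ (a₂ ≡ b₂ × a₃ ≤ b₃)))

_<ki_ : {n s : ℕ} → (Fin n × Fin s) → (Fin n × Fin s) → Set
(k , i) <ki (k' , i') = (k F.< k') ⊎ (k ≡ k' × i F.< i')

⟦_⟧ : {n : ℕ} → Fin n → ℕ
⟦ k ⟧ = suc (toℕ k)

Merges : {n s : ℕ} → VecPart n s → VecPart n s → Subset n → Subset n → Set
Merges x y I J =
    (∃[ p ] (I ≡ part x p)) × (∃[ q ] (J ≡ part x q)) × I ≢ J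
  × (∀ k → k ∈ (I ∪ J) → part y k ≡ (I ∪ J))
  × (∀ k → k ∉ (I ∪ J) → part y k ≡ part x k)

IsMax : {n : ℕ} → Subset n → Fin n → Set
IsMax S m = m ∈ S × (∀ l → l ∈ S → l F.≤ m)

-- λ(x ⋖ y) = ℓ, as a relation (defined on covering pairs)
data EdgeLabel {n s : ℕ} : Π n s → Π n s → Label → Set where
  bottom : ∀ a m → IsAtom a → AtomIndex a m →
           EdgeLabel 0̂ (el a) (n ∸ 1 , s + m , 0)
  differ : ∀ x y a b (k : Fin n) (i : Fin s) (j : Fin n) →
           IsA (el x) a → IsA (el y) b →
           label a i k ≢ label b i k →
           (∀ k' i' → (k' , i') <ki (k , i) → label a i' k' ≡ label b i' k') →
           j ∈ label b i k →
           EdgeLabel (el x) (el y) (⟦ k ⟧ , ⟦ i ⟧ , ⟦ j ⟧)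
  same   : ∀ x y a b I J m →
           IsA (el x) a → IsA (el y) b → a ≈V b →
           Merges x y I J → IsMax (I ∪ J) m →
           EdgeLabel (el x) (el y) (n , ⟦ m ⟧ , 0)

-- Maximal chains C_0 ⋖ C_1 ⋖ ... ⋖ C_n (indices ≥ n are irrelevant).

IsMaximalChain : (n s : ℕ) → (ℕ → Π n s) → Set
IsMaximalChain n s C =
    (∀ i → i ≤ n → InΠ (C i))
  × C 0 ≈ 0̂
  × (∀ i → i < n → C i ⋖ C (suc i))
  × (∀ z → InΠ z → ¬ (C n <Π z))

IsDecreasing : (n s : ℕ) → (ℕ → Π n s) → Set
IsDecreasing n s C =
  Σ (ℕ → Label) λ ℓ →
      (∀ i → i < n → EdgeLabel (C i) (C (suc i)) (ℓ i))
    × (∀ i → suc i < n → ℓ (suc i) ≤L ℓ i)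

-- The edge from 0̂ has first coordinate n − 1, and along a decreasing chain
-- the first coordinates can only go down, so every edge of the chain has first
-- coordinate at most n − 1.  An edge x ⋖ y with A(x) = A(y), however, must be
-- labelled by the merging rule, whose first coordinate is n: the rule for
-- A(x) ≠ A(y) cannot apply, because the lexicographically least atom below an
-- element is unique.
module Submission where

open import Defs
open import Data.Nat using (ℕ; suc; _≤_; _<_)
open import Data.Product using (_×_)
open import Relation.Nullary using (¬_)

open import Data.Nat using (zero; _∸_)
import Data.Nat.Properties as ℕ
open import Data.Fin using (_≟_)
import Data.Fin as Fin
import Data.Fin.Properties as Finₚ
open import Data.Fin.Subset using (Subset; ∣_∣; ⁅_⁆; _⊂_) renaming (_∈_ to _∈ₛ_)
open import Data.Fin.Subset.Properties
  using (∣⁅x⁆∣≡1; x∈⁅y⁆⇒x≡y; x≢y⇒x∉⁅y⁆; p⊂q⇒∣p∣<∣q∣)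
open import Data.Product using (_,_; proj₁; proj₂)
open import Data.Sum using (inj₁; inj₂)
open import Function using (_∘_)
open import Relation.Nullary using (yes; no; contradiction)
open import Relation.Binary.Definitions using (tri<; tri≈; tri>)
open import Relation.Binary.PropositionalEquality

∣p∣≡1⇒∈-unique : ∀ {n} {p : Subset n} {x y} → ∣ p ∣ ≡ 1 → x ∈ₛ p → y ∈ₛ p → x ≡ y
∣p∣≡1⇒∈-unique {p = p} {x} {y} ∣p∣≡1 x∈p y∈p with x ≟ y
... | yes x≡y = x≡y
... | no x≢y  = contradiction 1<∣p∣ (ℕ.<-irrefl (sym ∣p∣≡1))
  where
  ⁅x⁆⊂p : ⁅ x ⁆ ⊂ p
  ⁅x⁆⊂p = (λ z∈⁅x⁆ → subst (_∈ₛ p) (sym (x∈⁅y⁆⇒x≡y x z∈⁅x⁆)) x∈p)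
        , y , y∈p , x≢y⇒x∉⁅y⁆ (x≢y ∘ sym)
  1<∣p∣ : 1 < ∣ p ∣
  1<∣p∣ = subst (_< ∣ p ∣) (∣⁅x⁆∣≡1 x) (p⊂q⇒∣p∣<∣q∣ ⁅x⁆⊂p)

∣p∣≡1⇒≢-of-distinct-members : ∀ {n} {p q : Subset n} {x y} →
  ∣ p ∣ ≡ 1 → x ∈ₛ p → y ∈ₛ q → x ≢ y → p ≢ q
∣p∣≡1⇒≢-of-distinct-members ∣p∣≡1 x∈p y∈q x≢y refl = x≢y (∣p∣≡1⇒∈-unique ∣p∣≡1 x∈p y∈q)

IsAtom⇒∣label∣≡1 : ∀ {n s} {a : VecPart n s} → IsAtom a → ∀ i k → ∣ label a i k ∣ ≡ 1
IsAtom⇒∣label∣≡1 {a = a} (isVecPart , singletons) i k = begin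
  ∣ label a i k ∣ ≡⟨ IsVecPart.label-size isVecPart i k ⟩
  ∣ part a k ∣    ≡⟨ cong ∣_∣ (singletons k) ⟩
  ∣ ⁅ k ⁆ ∣       ≡⟨ ∣⁅x⁆∣≡1 k ⟩
  1               ∎
  where open ≡-Reasoning

atom-labels-≢ : ∀ {n s} {a b : VecPart n s} {i k j j′} → IsAtom a →
  j ∈ₛ label a i k → j′ ∈ₛ label b i k → j ≢ j′ → label a i k ≢ label b i k
atom-labels-≢ {i = i} {k} atom-a = ∣p∣≡1⇒≢-of-distinct-members (IsAtom⇒∣label∣≡1 atom-a i k)

<lex-asym : ∀ {n s} {a b : VecPart n s} → IsAtom a → IsAtom b → a <lex b → ¬ (b <lex a)
<lex-asym {a = a} {b} atom-a atom-b
  (i , k , j , j′ , a≡b-before , j∈a , j′∈b , j<j′)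
  (i′ , k′ , m , m′ , b≡a-before , m∈b , m′∈a , m<m′)
  with Finₚ.<-cmp i i′ | Finₚ.<-cmp k k′
... | tri< i<i′ _ _ | _ =
  atom-labels-≢ {b = b} atom-a j∈a j′∈b (Finₚ.<⇒≢ j<j′)
    (sym (b≡a-before i k (inj₁ i<i′)))
... | tri> _ _ i′<i | _ =
  atom-labels-≢ {b = a} atom-b m∈b m′∈a (Finₚ.<⇒≢ m<m′)
    (sym (a≡b-before i′ k′ (inj₁ i′<i)))
... | tri≈ _ refl _ | tri< k<k′ _ _ =
  atom-labels-≢ {b = b} atom-a j∈a j′∈b (Finₚ.<⇒≢ j<j′)
    (sym (b≡a-before i k (inj₂ (refl , k<k′))))
... | tri≈ _ refl _ | tri> _ _ k′<k =
  atom-labels-≢ {b = a} atom-b m∈b m′∈a (Finₚ.<⇒≢ m<m′)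
    (sym (a≡b-before i k′ (inj₂ (refl , k′<k))))
... | tri≈ _ refl _ | tri≈ _ refl _ = Finₚ.<-asym j<j′ (subst₂ Fin._<_ (sym j′≡m) m′≡j m<m′)
  where
  j′≡m : j′ ≡ m
  j′≡m = ∣p∣≡1⇒∈-unique (IsAtom⇒∣label∣≡1 atom-b i k) j′∈b m∈b
  m′≡j : m′ ≡ j
  m′≡j = ∣p∣≡1⇒∈-unique (IsAtom⇒∣label∣≡1 atom-a i k) m′∈a j∈a

IsA-unique : ∀ {n s} {x : Π n s} {a a′ : VecPart n s} → IsA x a → IsA x a′ → a ≈V a′
IsA-unique (atom-a , a≤x , a-least) (atom-a′ , a′≤x , a′-least)
  with a-least _ atom-a′ a′≤x | a′-least _ atom-a a≤x
... | inj₂ a≈a′ | _         = a≈a′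
... | inj₁ _    | inj₂ a′≈a = (λ k → sym (proj₁ a′≈a k)) , (λ i k → sym (proj₂ a′≈a i k))
... | inj₁ a<a′ | inj₁ a′<a = contradiction a′<a (<lex-asym atom-a atom-a′ a<a′)

≤L⇒proj₁-≤ : ∀ {l l′ : Label} → l ≤L l′ → proj₁ l ≤ proj₁ l′
≤L⇒proj₁-≤ (inj₁ l₁<l′₁)       = ℕ.<⇒≤ l₁<l′₁
≤L⇒proj₁-≤ (inj₂ (l₁≡l′₁ , _)) = ℕ.≤-reflexive l₁≡l′₁

antitone-labels⇒proj₁-≤-initial : ∀ {n} (ℓ : ℕ → Label) →
  (∀ i → suc i < n → ℓ (suc i) ≤L ℓ i) →
  ∀ i → i < n → proj₁ (ℓ i) ≤ proj₁ (ℓ 0)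
antitone-labels⇒proj₁-≤-initial ℓ antitone zero    _   = ℕ.≤-refl
antitone-labels⇒proj₁-≤-initial ℓ antitone (suc i) i<n = ℕ.≤-trans
  (≤L⇒proj₁-≤ (antitone i i<n))
  (antitone-labels⇒proj₁-≤-initial ℓ antitone i (ℕ.<-trans (ℕ.n<1+n i) i<n))

EdgeLabel-from-0̂ : ∀ {n s} {u v : Π n s} {l} → u ≈ 0̂ → EdgeLabel u v l → proj₁ l ≡ n ∸ 1
EdgeLabel-from-0̂ {u = 0̂} _ (bottom _ _ _ _) = refl

EdgeLabel-between-equal-As : ∀ {n s} {u v : Π n s} {a b l} →
  IsA u a → IsA v b → a ≈V b → EdgeLabel u v l → proj₁ l ≡ n
EdgeLabel-between-equal-As (_ , () , _) _ _ (bottom _ _ _ _)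
EdgeLabel-between-equal-As {a = a} {b} A-a A-b (_ , a≡b)
  (differ _ _ a′ b′ k i _ A-a′ A-b′ a′≢b′ _ _) =
  contradiction a′≡b′ a′≢b′
  where
  open ≡-Reasoning
  a′≡b′ : label a′ i k ≡ label b′ i k
  a′≡b′ = begin
    label a′ i k ≡⟨ proj₂ (IsA-unique A-a′ A-a) i k ⟩
    label a  i k ≡⟨ a≡b i k ⟩
    label b  i k ≡⟨ proj₂ (IsA-unique A-b A-b′) i k ⟩
    label b′ i k ∎
EdgeLabel-between-equal-As _ _ _ (same _ _ _ _ _ _ _ _ _ _ _ _) = refl

proposition4p1 : (n s : ℕ) → 1 ≤ n → 1 ≤ s → (C : ℕ → Π n s) →
    IsMaximalChain n s C → IsDecreasing n s C →
    ∀ i → 1 ≤ i → i < n →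
    ∀ a b → IsA (C i) a → IsA (C (suc i)) b → ¬ (a ≈V b)
proposition4p1 (suc n) s _ _ C (_ , C₀≈0̂ , _) (ℓ , edge , antitone) i _ i<n a b A-a A-b a≈b =
  ℕ.1+n≰n (begin
    suc n         ≡⟨ sym (EdgeLabel-between-equal-As A-a A-b a≈b (edge i i<n)) ⟩
    proj₁ (ℓ i)   ≤⟨ antitone-labels⇒proj₁-≤-initial ℓ antitone i i<n ⟩
    proj₁ (ℓ 0)   ≡⟨ EdgeLabel-from-0̂ C₀≈0̂ (edge 0 ℕ.0<1+n) ⟩
    n             ∎)
  where open ℕ.≤-Reasoning
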